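{- Let $p$ be an odd prime and $\mathbb{F}_p=\mathbb{Z}/p\mathbb{Z}$. For $t\in\mathbb{F}_p$, let $N_p(t)$ denote the number of pairs $(x,y)\in(\mathbb{F}_p^*)^2$ satisfying $x+\frac{1}{x}+y+\frac{1}{y}=t$. Then for every $t\in\mathbb{F}_p$, $N_p(t)\le N_p(0)=2p-4$.
   Context: $\mathbb{F}_p^*$ denotes the nonzero elements of $\mathbb{F}_p$, and $\frac1x$ denotes the multiplicative inverse of $x$ in $\mathbb{F}_p$. -}

module Defs where

open import Data.Nat using (ℕ; zero; suc; _+_; _*_; _%_; NonZero)
open import Data.Nat.Primality using (Prime; prime⇒nonZero)
open import Data.Nat using (_<_; s≤s; z≤n)
open import Data.Fin using (Fin; toℕ; fromℕ<)
open import Data.Nat using (>-nonZero⁻¹)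
open import Data.Fin.Properties using (any?)
open import Data.Product using (_×_; Σ; _,_; ∃)
open import Data.List using (List; length; filter)
open import Data.List using (allFin; cartesianProduct)
open import Relation.Binary.PropositionalEquality using (_≡_)
open import Relation.Nullary using (¬_; Dec)
open import Relation.Nullary.Decidable using (¬?; _×-dec_)
open import Data.Nat.Properties using (_≟_)

-- 𝔽_p is modelled as Fin p, with element x ↦ residue toℕ x ∈ {0,…,p-1}.
-- Arithmetic is done on representatives in ℕ and compared modulo p.

_≡[_]_ : ℕ → (p : ℕ) → .{{NonZero p}} → ℕ → Set
a ≡[ p ] b = a % p ≡ b % p

IsInv : (p : ℕ) → .{{NonZero p}} → Fin p → Fin p → Set
IsInv p x x' = (toℕ x * toℕ x') ≡[ p ] 1

NonZeroF : (p : ℕ) → Fin p → Set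
NonZeroF p x = ¬ (toℕ x ≡ 0)

-- (x , y) ∈ (𝔽_p^*)² satisfies x + 1/x + y + 1/y = t
-- (1/x, 1/y are the inverses, which exist and are unique for x,y ≠ 0)
Sol : (p : ℕ) → .{{NonZero p}} → Fin p → Fin p × Fin p → Set
Sol p t (x , y) =
  NonZeroF p x × NonZeroF p y ×
  Σ (Fin p) λ x' → Σ (Fin p) λ y' →
    IsInv p x x' × IsInv p y y' ×
    ((toℕ x + toℕ x' + toℕ y + toℕ y') ≡[ p ] toℕ t)

sol? : (p : ℕ) → .{{_ : NonZero p}} → (t : Fin p) → (xy : Fin p × Fin p) → Dec (Sol p t xy)
sol? p t (x , y) =
  ¬? (toℕ x ≟ 0) ×-dec ¬? (toℕ y ≟ 0) ×-dec
  any? (λ x' → any? (λ y' →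
    ((toℕ x * toℕ x') % p ≟ 1 % p) ×-dec ((toℕ y * toℕ y') % p ≟ 1 % p) ×-dec
    ((toℕ x + toℕ x' + toℕ y + toℕ y') % p ≟ toℕ t % p)))

N : (p : ℕ) → .{{_ : NonZero p}} → Fin p → ℕ
N p t = length (filter (sol? p t) (cartesianProduct (allFin p) (allFin p)))

0F : (p : ℕ) → .{{NonZero p}} → Fin p
0F p = fromℕ< (>-nonZero⁻¹ p)

Np : (p : ℕ) → Prime p → Fin p → ℕ
Np p pp t = N p {{prime⇒nonZero pp}} t

0Fp : (p : ℕ) → Prime p → Fin p
0Fp p pp = 0F p {{prime⇒nonZero pp}}

module Submission where

-- Write ψ x = x + 1/x and r u = #{x ∈ 𝔽_p^* ∣ ψ x = u}. Then N_p(t) = ∑_u r(u) r(t - u), and since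
-- u ↦ t - u permutes 𝔽_p, 2 r(u) r(t - u) ≤ r(u)² + r(t - u)² gives N_p(t) ≤ ∑_u r(u)². For t = 0 this is
-- an equality: ψ is odd, so x ↦ -x carries the fibre over u onto the fibre over -u and r(-u) = r(u).
-- Finally ∑_u r(u)² counts pairs with ψ x = ψ y, i.e. (x - y)(xy - 1) = 0, i.e. y ∈ {x, 1/x}; these are two
-- solutions for each x except the two x = ±1 (distinct as p ≠ 2) with x = 1/x, in total 2(p - 1) - 2 = 2p - 4.

open import Data.Nat using (ℕ)
open import Data.Nat.Primality using (Prime)
open import Defs

module Counting where

  open import Level using (Level)
  open import Data.Nat using (zero; suc; _+_; _*_; _≤_; z≤n)
  open import Data.Nat.Properties
    using (+-*-semiring; +-mono-≤; +-comm; *-comm; *-assoc; *-identityˡ; *-identityʳ; +-identityʳ;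
           *-cancelˡ-≤; m≤m+n; ≤-total; m≤n⇒∃[o]m+o≡n; module ≤-Reasoning)
  open import Data.Nat.Tactic.RingSolver using (solve-∀)
  open import Algebra.Properties.Semiring.Sum +-*-semiring
    using (sum-syntax; sum-cong-≗; sum-replicate-zero; ∑-distrib-+; ∑-comm; ∑-permute; *-distribˡ-sum; *-distribʳ-sum)
  open import Data.Fin using (Fin; zero; suc)
  open import Data.Fin.Properties using (_≟_; suc-injective)
  open import Data.Fin.Permutation using (Permutation; _⟨$⟩ʳ_)
  open import Data.List using (List; _∷_; _++_; length; filter; map; tabulate; allFin; cartesianProduct)
  open import Data.List.Properties using (length-++; filter-++; map-tabulate)
  open import Data.Product using (_×_; _,_)
  open import Data.Sum using (_⊎_; inj₁; inj₂; [_,_])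
  open import Function using (id; _∘_; _⇔_; mk⇔; Equivalence)
  open import Relation.Nullary using (Dec; yes; no; ¬_; ¬?; _×-dec_; contradiction)
  open import Relation.Unary using (Pred; Decidable)
  open import Relation.Binary.PropositionalEquality
    using (_≡_; refl; sym; trans; cong; cong₂; subst; subst₂; module ≡-Reasoning)

  private
    variable
      ℓ : Level
      A B C : Set ℓ
      m n : ℕ

  𝟙 : Dec A → ℕ
  𝟙 (yes _) = 1
  𝟙 (no _)  = 0

  𝟙-yes : A → (a? : Dec A) → 𝟙 a? ≡ 1
  𝟙-yes a (yes _) = refl
  𝟙-yes a (no ¬a) = contradiction a ¬a

  𝟙-no : ¬ A → (a? : Dec A) → 𝟙 a? ≡ 0
  𝟙-no ¬a (yes a) = contradiction a ¬a
  𝟙-no ¬a (no _)  = refl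

  𝟙-cong : A ⇔ B → (a? : Dec A) (b? : Dec B) → 𝟙 a? ≡ 𝟙 b?
  𝟙-cong A⇔B (yes a) b? = sym (𝟙-yes (Equivalence.to A⇔B a) b?)
  𝟙-cong A⇔B (no ¬a) b? = sym (𝟙-no (¬a ∘ Equivalence.from A⇔B) b?)

  𝟙-×-dec : (a? : Dec A) (b? : Dec B) → 𝟙 a? * 𝟙 b? ≡ 𝟙 (a? ×-dec b?)
  𝟙-×-dec (yes _) (yes _) = refl
  𝟙-×-dec (yes _) (no _)  = refl
  𝟙-×-dec (no _)  _       = refl

  𝟙-¬?+𝟙 : (a? : Dec A) → 𝟙 (¬? a?) + 𝟙 a? ≡ 1
  𝟙-¬?+𝟙 (yes _) = refl
  𝟙-¬?+𝟙 (no _)  = refl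

  𝟙-disjoint-⊎ : ¬ (A × B) → C ⇔ (A ⊎ B) → (a? : Dec A) (b? : Dec B) (c? : Dec C) → 𝟙 c? ≡ 𝟙 a? + 𝟙 b?
  𝟙-disjoint-⊎ ¬a×b C⇔A⊎B (yes a) (yes b) c? = contradiction (a , b) ¬a×b
  𝟙-disjoint-⊎ ¬a×b C⇔A⊎B (yes a) (no _)  c? = 𝟙-yes (Equivalence.from C⇔A⊎B (inj₁ a)) c?
  𝟙-disjoint-⊎ ¬a×b C⇔A⊎B (no _)  (yes b) c? = 𝟙-yes (Equivalence.from C⇔A⊎B (inj₂ b)) c?
  𝟙-disjoint-⊎ ¬a×b C⇔A⊎B (no ¬a) (no ¬b) c? = 𝟙-no ([ ¬a , ¬b ] ∘ Equivalence.to C⇔A⊎B) c?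

  ∑-mono-≤ : {f g : Fin n → ℕ} → (∀ i → f i ≤ g i) → ∑[ i < n ] f i ≤ ∑[ i < n ] g i
  ∑-mono-≤ {zero}  f≤g = z≤n
  ∑-mono-≤ {suc n} f≤g = +-mono-≤ (f≤g zero) (∑-mono-≤ (f≤g ∘ suc))

  ∑-one : ∀ n → ∑[ i < n ] 1 ≡ n
  ∑-one zero    = refl
  ∑-one (suc n) = cong suc (∑-one n)

  ∑-pick : (i : Fin n) (f : Fin n → ℕ) → ∑[ j < n ] (𝟙 (i ≟ j) * f j) ≡ f i
  ∑-pick {suc n} zero f = begin
    1 * f zero + ∑[ j < n ] (0 * f (suc j))  ≡⟨ cong₂ _+_ (*-identityˡ (f zero)) (sum-replicate-zero n) ⟩
    f zero + 0                               ≡⟨ +-identityʳ (f zero) ⟩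
    f zero                                   ∎
    where open ≡-Reasoning
  ∑-pick {suc n} (suc i) f = trans (sum-cong-≗ same) (∑-pick i (f ∘ suc))
    where
      same : ∀ j → 𝟙 (suc i ≟ suc j) * f (suc j) ≡ 𝟙 (i ≟ j) * f (suc j)
      same j = cong (_* f (suc j)) (𝟙-cong (mk⇔ suc-injective (cong suc)) (suc i ≟ suc j) (i ≟ j))

  ∑-𝟙-unique : {P : Pred (Fin n) ℓ} (P? : Decidable P) (i : Fin n) →
               (∀ j → P j ⇔ (i ≡ j)) → ∑[ j < n ] 𝟙 (P? j) ≡ 1
  ∑-𝟙-unique {n} P? i P⇔ = trans (sum-cong-≗ as-pick) (∑-pick i (λ _ → 1))
    where
      as-pick : ∀ j → 𝟙 (P? j) ≡ 𝟙 (i ≟ j) * 1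
      as-pick j = trans (𝟙-cong (P⇔ j) (P? j) (i ≟ j)) (sym (*-identityʳ _))

  ∑-𝟙-pair : {P : Pred (Fin n) ℓ} (P? : Decidable P) (c d : Fin n) →
             (∀ j → P j ⇔ (c ≡ j ⊎ d ≡ j)) → ∑[ j < n ] 𝟙 (P? j) + 𝟙 (c ≟ d) ≡ 2
  ∑-𝟙-pair {n} P? c d P⇔ with c ≟ d
  ... | yes refl = cong (_+ 1) (∑-𝟙-unique P? c λ j → mk⇔ ([ id , id ] ∘ Equivalence.to (P⇔ j)) (Equivalence.from (P⇔ j) ∘ inj₁))
  ... | no c≢d = begin
    ∑[ j < n ] 𝟙 (P? j) + 0                       ≡⟨ +-identityʳ _ ⟩
    ∑[ j < n ] 𝟙 (P? j)                           ≡⟨ sum-cong-≗ split ⟩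
    ∑[ j < n ] (𝟙 (c ≟ j) + 𝟙 (d ≟ j))            ≡⟨ ∑-distrib-+ (λ j → 𝟙 (c ≟ j)) (λ j → 𝟙 (d ≟ j)) ⟩
    ∑[ j < n ] 𝟙 (c ≟ j) + ∑[ j < n ] 𝟙 (d ≟ j)   ≡⟨ cong₂ _+_ (∑-𝟙-unique (c ≟_) c λ _ → mk⇔ id id)
                                                             (∑-𝟙-unique (d ≟_) d λ _ → mk⇔ id id) ⟩
    2                                             ∎
    where
      open ≡-Reasoning
      split : ∀ j → 𝟙 (P? j) ≡ 𝟙 (c ≟ j) + 𝟙 (d ≟ j)
      split j = 𝟙-disjoint-⊎ (λ (c≡j , d≡j) → c≢d (trans c≡j (sym d≡j))) (P⇔ j) (c ≟ j) (d ≟ j) (P? j)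

  ∑-fibres : (w : Fin m → ℕ) (g : Fin m → Fin n) (F : Fin n → ℕ) →
             ∑[ x < m ] (w x * F (g x)) ≡ ∑[ u < n ] (∑[ x < m ] (w x * 𝟙 (g x ≟ u)) * F u)
  ∑-fibres {m} {n} w g F = begin
    ∑[ x < m ] (w x * F (g x))                          ≡⟨ sum-cong-≗ (λ x → cong (w x *_) (sym (∑-pick (g x) F))) ⟩
    ∑[ x < m ] (w x * ∑[ u < n ] (𝟙 (g x ≟ u) * F u))   ≡⟨ sum-cong-≗ (λ x → *-distribˡ-sum (w x) (λ u → 𝟙 (g x ≟ u) * F u)) ⟩
    ∑[ x < m ] ∑[ u < n ] (w x * (𝟙 (g x ≟ u) * F u))   ≡⟨ ∑-comm (λ x u → w x * (𝟙 (g x ≟ u) * F u)) ⟩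
    ∑[ u < n ] ∑[ x < m ] (w x * (𝟙 (g x ≟ u) * F u))   ≡⟨ sum-cong-≗ (λ u → sum-cong-≗ (λ x → sym (*-assoc (w x) _ (F u)))) ⟩
    ∑[ u < n ] ∑[ x < m ] (w x * 𝟙 (g x ≟ u) * F u)     ≡⟨ sum-cong-≗ (λ u → sym (*-distribʳ-sum (F u) (λ x → w x * 𝟙 (g x ≟ u)))) ⟩
    ∑[ u < n ] (∑[ x < m ] (w x * 𝟙 (g x ≟ u)) * F u)   ∎
    where open ≡-Reasoning

  m≤n⇒2mn≤m²+n² : m ≤ n → 2 * (m * n) ≤ m * m + n * n
  m≤n⇒2mn≤m²+n² {m} m≤n with k , refl ← m≤n⇒∃[o]m+o≡n m≤n =
    subst (2 * (m * (m + k)) ≤_) (expand m k) (m≤m+n (2 * (m * (m + k))) (k * k))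
    where
      expand : ∀ m k → 2 * (m * (m + k)) + k * k ≡ m * m + (m + k) * (m + k)
      expand = solve-∀

  2mn≤m²+n² : ∀ m n → 2 * (m * n) ≤ m * m + n * n
  2mn≤m²+n² m n with ≤-total m n
  ... | inj₁ m≤n = m≤n⇒2mn≤m²+n² m≤n
  ... | inj₂ n≤m = subst₂ _≤_ (cong (2 *_) (*-comm n m)) (+-comm (n * n) (m * m)) (m≤n⇒2mn≤m²+n² n≤m)

  ∑-*-permute-≤ : (π : Permutation n n) (f : Fin n → ℕ) →
                  ∑[ u < n ] (f u * f (π ⟨$⟩ʳ u)) ≤ ∑[ u < n ] (f u * f u)
  ∑-*-permute-≤ {n} π f = *-cancelˡ-≤ 2 (begin
    2 * ∑[ u < n ] (f u * f (π ⟨$⟩ʳ u))                          ≡⟨ *-distribˡ-sum 2 (λ u → f u * f (π ⟨$⟩ʳ u)) ⟩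
    ∑[ u < n ] (2 * (f u * f (π ⟨$⟩ʳ u)))                        ≤⟨ ∑-mono-≤ (λ u → 2mn≤m²+n² (f u) (f (π ⟨$⟩ʳ u))) ⟩
    ∑[ u < n ] (square u + square (π ⟨$⟩ʳ u))                    ≡⟨ ∑-distrib-+ square (square ∘ (π ⟨$⟩ʳ_)) ⟩
    ∑[ u < n ] square u + ∑[ u < n ] square (π ⟨$⟩ʳ u)           ≡⟨ cong (∑[ u < n ] square u +_) (∑-permute square π) ⟨
    ∑[ u < n ] square u + ∑[ u < n ] square u                    ≡⟨ cong (∑[ u < n ] square u +_) (+-identityʳ _) ⟨
    2 * ∑[ u < n ] square u                                      ∎)
    where
      open ≤-Reasoning
      square : Fin n → ℕ
      square u = f u * f u

  count : {P : Pred A ℓ} → Decidable P → List A → ℕ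
  count P? xs = length (filter P? xs)

  count-∷ : {P : Pred A ℓ} (P? : Decidable P) (x : A) (xs : List A) → count P? (x ∷ xs) ≡ 𝟙 (P? x) + count P? xs
  count-∷ P? x xs with P? x
  ... | yes _ = refl
  ... | no _  = refl

  count-++ : {P : Pred A ℓ} (P? : Decidable P) (xs ys : List A) → count P? (xs ++ ys) ≡ count P? xs + count P? ys
  count-++ P? xs ys = trans (cong length (filter-++ P? xs ys)) (length-++ (filter P? xs))

  count-tabulate : {P : Pred A ℓ} (P? : Decidable P) (f : Fin n → A) → count P? (tabulate f) ≡ ∑[ i < n ] 𝟙 (P? (f i))
  count-tabulate {n = zero}  P? f = refl
  count-tabulate {n = suc n} P? f = trans (count-∷ P? (f zero) _) (cong (𝟙 (P? (f zero)) +_) (count-tabulate P? (f ∘ suc)))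

  count-cartesianProduct : {P : Pred (A × B) ℓ} (P? : Decidable P) (f : Fin m → A) (ys : List B) →
                           count P? (cartesianProduct (tabulate f) ys) ≡ ∑[ i < m ] count P? (map (f i ,_) ys)
  count-cartesianProduct {m = zero}  P? f ys = refl
  count-cartesianProduct {m = suc m} P? f ys =
    trans (count-++ P? (map (f zero ,_) ys) _) (cong (count P? (map (f zero ,_) ys) +_) (count-cartesianProduct P? (f ∘ suc) ys))

  count-allFin² : {P : Pred (Fin m × Fin n) ℓ} (P? : Decidable P) →
                  count P? (cartesianProduct (allFin m) (allFin n)) ≡ ∑[ i < m ] ∑[ j < n ] 𝟙 (P? (i , j))
  count-allFin² {n = n} P? = trans (count-cartesianProduct P? id (allFin n)) (sum-cong-≗ row)
    where
      row : ∀ i → count P? (map (i ,_) (allFin n)) ≡ ∑[ j < n ] 𝟙 (P? (i , j))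
      row i = trans (cong (count P?) (map-tabulate id (i ,_))) (count-tabulate P? (i ,_))

module Congruence (p : ℕ) where

  open import Data.Nat as ℕ using (zero; suc; NonZero)
  open import Data.Nat.Divisibility as ℕ∣ using (∣⇒≤)
  open import Data.Nat.Primality using (euclidsLemma)
  open import Data.Integer using (ℤ; +_; -_; _+_; _-_; _*_; ∣_∣; _%ℕ_; _/ℕ_)
  open import Data.Integer.Properties
    using (+-identityʳ; +-inverseʳ; *-identityˡ; *-identityʳ; abs-*; ∣i∣≡0⇒i≡0; [+m]-[+n]≡m⊖n; ∣m⊝n∣≤m⊔n;
           i-j≡0⇒i≡j; +-injective; pos-+; pos-*)
  open import Data.Integer.DivMod using (a≡a%ℕn+[a/ℕn]*n)
  open import Data.Integer.Divisibility.Signed using (_∣_; divides; ∣m∣n⇒∣m+n; ∣m⇒∣-m; ∣m⇒∣m*n; ∣n⇒∣m*n; ∣⇒∣ᵤ; ∣ᵤ⇒∣)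
  open import Data.Integer.Tactic.RingSolver using (solve-∀)
  open import Data.Nat.Properties using (<⇒≱; ⊔-lub; ≤-<-trans)
  open import Data.Sum using (_⊎_; map)
  open import Relation.Binary.Bundles using (Setoid)
  import Relation.Binary.Reasoning.Setoid as ≈-Reasoning
  open import Relation.Binary.PropositionalEquality using (_≡_; refl; sym; trans; cong; subst; module ≡-Reasoning)
  open import Relation.Nullary using (contradiction)
  open import Function using (_∘_; _⇔_; mk⇔; Equivalence)

  -- A record rather than a type synonym, so that i and j can be inferred from i ≈ j.
  infix 4 _≈_
  record _≈_ (i j : ℤ) : Set where
    constructor mk≈
    field p∣i-j : + p ∣ i - j
  open _≈_ public

  ≈-by : ∀ {i j k} → + p ∣ k → k ≡ i - j → i ≈ j
  ≈-by p∣k refl = mk≈ p∣k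

  ≈-reflexive : ∀ {i j} → i ≡ j → i ≈ j
  ≈-reflexive {i} refl = mk≈ (divides (+ 0) (+-inverseʳ i))

  ≈-refl : ∀ {i} → i ≈ i
  ≈-refl = ≈-reflexive refl

  ≈-sym : ∀ {i j} → i ≈ j → j ≈ i
  ≈-sym {i} {j} (mk≈ d) = ≈-by (∣m⇒∣-m d) (-[i-j]≡j-i i j)
    where
      -[i-j]≡j-i : ∀ i j → - (i - j) ≡ j - i
      -[i-j]≡j-i = solve-∀

  ≈-trans : ∀ {i j k} → i ≈ j → j ≈ k → i ≈ k
  ≈-trans {i} {j} {k} (mk≈ d) (mk≈ e) = ≈-by (∣m∣n⇒∣m+n d e) ([i-j]+[j-k]≡i-k i j k)
    where
      [i-j]+[j-k]≡i-k : ∀ i j k → (i - j) + (j - k) ≡ i - k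
      [i-j]+[j-k]≡i-k = solve-∀

  ≈-setoid : Setoid _ _
  ≈-setoid = record { _≈_ = _≈_ ; isEquivalence = record { refl = ≈-refl ; sym = ≈-sym ; trans = ≈-trans } }

  +-cong : ∀ {i j k l} → i ≈ j → k ≈ l → i + k ≈ j + l
  +-cong {i} {j} {k} {l} (mk≈ d) (mk≈ e) = ≈-by (∣m∣n⇒∣m+n d e) ([i-j]+[k-l]≡[i+k]-[j+l] i j k l)
    where
      [i-j]+[k-l]≡[i+k]-[j+l] : ∀ i j k l → (i - j) + (k - l) ≡ (i + k) - (j + l)
      [i-j]+[k-l]≡[i+k]-[j+l] = solve-∀

  -‿cong : ∀ {i j} → i ≈ j → - i ≈ - j
  -‿cong {i} {j} (mk≈ d) = ≈-by (∣m⇒∣-m d) (-[i-j]≡[-i]-[-j] i j)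
    where
      -[i-j]≡[-i]-[-j] : ∀ i j → - (i - j) ≡ (- i) - (- j)
      -[i-j]≡[-i]-[-j] = solve-∀

  *-cong : ∀ {i j k l} → i ≈ j → k ≈ l → i * k ≈ j * l
  *-cong {i} {j} {k} {l} (mk≈ d) (mk≈ e) = ≈-by (∣m∣n⇒∣m+n (∣m⇒∣m*n k d) (∣n⇒∣m*n j e)) ([i-j]k+j[k-l]≡ik-jl i j k l)
    where
      [i-j]k+j[k-l]≡ik-jl : ∀ i j k l → (i - j) * k + j * (k - l) ≡ i * k - j * l
      [i-j]k+j[k-l]≡ik-jl = solve-∀

  ∣⇔≈0 : ∀ {i} → + p ∣ i ⇔ i ≈ + 0
  ∣⇔≈0 {i} = mk⇔ (λ d → ≈-by d (sym (+-identityʳ i))) (λ (mk≈ d) → subst (+ p ∣_) (+-identityʳ i) d)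

  ≈-%ℕ : .{{_ : NonZero p}} → ∀ i → + (i %ℕ p) ≈ i
  ≈-%ℕ i = ≈-by (∣m⇒∣-m (divides (i /ℕ p) refl))
                 (trans (-[qp]≡r-[r+qp] r (i /ℕ p) (+ p)) (cong (λ k → r - k) (sym (a≡a%ℕn+[a/ℕn]*n i p))))
    where
      r : ℤ
      r = + (i %ℕ p)
      -[qp]≡r-[r+qp] : ∀ r q p → - (q * p) ≡ r - (r + q * p)
      -[qp]≡r-[r+qp] = solve-∀

  +[m+kp]≈+m : ∀ m k → + (m ℕ.+ k ℕ.* p) ≈ + m
  +[m+kp]≈+m m k = ≈-by (divides (+ k) refl) (begin
    + k * + p                    ≡⟨ kp≡[m+kp]-m (+ m) (+ k) (+ p) ⟩
    (+ m + + k * + p) - + m      ≡⟨ cong (λ j → j - + m) (trans (pos-+ m (k ℕ.* p)) (cong (λ j → + m + j) (pos-* k p))) ⟨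
    + (m ℕ.+ k ℕ.* p) - + m      ∎)
    where
      open ≡-Reasoning
      kp≡[m+kp]-m : ∀ m k p → k * p ≡ (m + k * p) - m
      kp≡[m+kp]-m = solve-∀

  small-multiple≡0 : ∀ {i} → + p ∣ i → ∣ i ∣ ℕ.< p → i ≡ + 0
  small-multiple≡0 {i} p∣i ∣i∣<p with ∣ i ∣ in eq | ∣⇒∣ᵤ p∣i | ∣i∣<p
  ... | zero  | _   | _   = ∣i∣≡0⇒i≡0 eq
  ... | suc _ | p∣k | k<p = contradiction (∣⇒≤ p∣k) (<⇒≱ k<p)

  +-injective-≈ : ∀ {m n} → m ℕ.< p → n ℕ.< p → + m ≈ + n → m ≡ n
  +-injective-≈ {m} {n} m<p n<p (mk≈ p∣m-n) = +-injective (i-j≡0⇒i≡j (+ m) (+ n) (small-multiple≡0 p∣m-n ∣m-n∣<p))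
    where
      ∣m-n∣<p : ∣ + m - + n ∣ ℕ.< p
      ∣m-n∣<p = subst (λ k → ∣ k ∣ ℕ.< p) (sym ([+m]-[+n]≡m⊖n m n)) (≤-<-trans (∣m⊝n∣≤m⊔n m n) (⊔-lub m<p n<p))

  ≈-resp-⇔ : ∀ {i i′ j j′} → i ≈ i′ → j ≈ j′ → (i ≈ j) ⇔ (i′ ≈ j′)
  ≈-resp-⇔ i≈i′ j≈j′ = mk⇔ (λ i≈j → ≈-trans (≈-sym i≈i′) (≈-trans i≈j j≈j′))
                            (λ i′≈j′ → ≈-trans i≈i′ (≈-trans i′≈j′ (≈-sym j≈j′)))

  i+j≈k⇔j≈k-i : ∀ {i j k} → i + j ≈ k ⇔ j ≈ k - i
  i+j≈k⇔j≈k-i {i} {j} {k} = mk⇔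
    (λ i+j≈k → ≈-trans (≈-reflexive (j≡[i+j]-i i j)) (+-cong i+j≈k (≈-refl { - i })))
    (λ j≈k-i → ≈-trans (+-cong (≈-refl {i}) j≈k-i) (≈-reflexive (i+[k-i]≡k i k)))
    where
      j≡[i+j]-i : ∀ i j → j ≡ (i + j) - i
      j≡[i+j]-i = solve-∀
      i+[k-i]≡k : ∀ i k → i + (k - i) ≡ k
      i+[k-i]≡k = solve-∀

  i-j≈0⇒i≈j : ∀ {i j} → i - j ≈ + 0 → i ≈ j
  i-j≈0⇒i≈j {i} {j} i-j≈0 = mk≈ (Equivalence.from ∣⇔≈0 i-j≈0)

  inverse-unique : ∀ {i j k} → i * j ≈ + 1 → i * k ≈ + 1 → j ≈ k
  inverse-unique {i} {j} {k} ij≈1 ik≈1 = begin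
    j             ≡⟨ *-identityʳ j ⟨
    j * + 1       ≈⟨ *-cong (≈-refl {j}) (≈-sym ik≈1) ⟩
    j * (i * k)   ≡⟨ j[ik]≡[ij]k i j k ⟩
    (i * j) * k   ≈⟨ *-cong ij≈1 (≈-refl {k}) ⟩
    + 1 * k       ≡⟨ *-identityˡ k ⟩
    k             ∎
    where
      open ≈-Reasoning ≈-setoid
      j[ik]≡[ij]k : ∀ i j k → j * (i * k) ≡ (i * j) * k
      j[ik]≡[ij]k = solve-∀

  module _ (prime : Prime p) where

    i*j≈0⇒i≈0∨j≈0 : ∀ {i j} → i * j ≈ + 0 → i ≈ + 0 ⊎ j ≈ + 0
    i*j≈0⇒i≈0∨j≈0 {i} {j} ij≈0 =
      map (to ∣⇔≈0 ∘ ∣ᵤ⇒∣) (to ∣⇔≈0 ∘ ∣ᵤ⇒∣)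
          (euclidsLemma ∣ i ∣ ∣ j ∣ prime (subst (p ℕ∣.∣_) (abs-* i j) (∣⇒∣ᵤ (from ∣⇔≈0 ij≈0))))
      where open Equivalence

    i*i≈1⇒i≈1∨i≈-1 : ∀ {i} → i * i ≈ + 1 → i ≈ + 1 ⊎ i ≈ - + 1
    i*i≈1⇒i≈1∨i≈-1 {i} ii≈1 = map i-j≈0⇒i≈j i-j≈0⇒i≈j (i*j≈0⇒i≈0∨j≈0 factored)
      where
        open ≈-Reasoning ≈-setoid
        [i-1][i+1]≡i²-1 : ∀ i → (i - + 1) * (i - - + 1) ≡ i * i - + 1
        [i-1][i+1]≡i²-1 = solve-∀
        factored : (i - + 1) * (i - - + 1) ≈ + 0
        factored = begin
          (i - + 1) * (i - - + 1)  ≡⟨ [i-1][i+1]≡i²-1 i ⟩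
          i * i - + 1              ≈⟨ +-cong ii≈1 ≈-refl ⟩
          + 1 - + 1                ≡⟨⟩
          + 0                      ∎

    i+i′≈j+j′⇒i≈j∨ij≈1 : ∀ {i i′ j j′} → i * i′ ≈ + 1 → j * j′ ≈ + 1 → i + i′ ≈ j + j′ → i ≈ j ⊎ i * j ≈ + 1
    i+i′≈j+j′⇒i≈j∨ij≈1 {i} {i′} {j} {j′} ii′≈1 jj′≈1 sum≈ = map i-j≈0⇒i≈j i-j≈0⇒i≈j (i*j≈0⇒i≈0∨j≈0 factored)
      where
        open ≈-Reasoning ≈-setoid
        expand : ∀ i i′ j j′ → (i - j) * (i * j - + 1) ≡
                 i * j * (i + i′) - i * j * (j + j′) - j * (i * i′ - + 1) + i * (j * j′ - + 1)
        expand = solve-∀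
        cancel : ∀ i j s → i * j * s - i * j * s - j * (+ 1 - + 1) + i * (+ 1 - + 1) ≡ + 0
        cancel = solve-∀
        factored : (i - j) * (i * j - + 1) ≈ + 0
        factored = begin
          (i - j) * (i * j - + 1)                                                ≡⟨ expand i i′ j j′ ⟩
          i * j * (i + i′) - i * j * (j + j′) - j * (i * i′ - + 1) + i * (j * j′ - + 1)
            ≈⟨ +-cong (+-cong (+-cong (*-cong (≈-refl {i * j}) sum≈) ≈-refl) (-‿cong (*-cong (≈-refl {j}) (+-cong ii′≈1 ≈-refl))))
                      (*-cong (≈-refl {i}) (+-cong jj′≈1 ≈-refl)) ⟩
          i * j * (j + j′) - i * j * (j + j′) - j * (+ 1 - + 1) + i * (+ 1 - + 1) ≡⟨ cancel i j (j + j′) ⟩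
          + 0                                                                    ∎

-- Identities in 𝔽_p are proved for the integer representatives ⟦ x ⟧ modulo p and transported back along ⟦⟧-injective.
module PrimeField (p : ℕ) (prime : Prime p) where

  open import Data.Nat as ℕ using (NonZero; ≢-nonZero; nonTrivial⇒n>1)
  open import Data.Nat.DivMod using (m%n<n)
  open import Data.Nat.Primality using (prime⇒nonZero; prime⇒nonTrivial)
  open import Data.Nat.Coprimality using (prime⇒coprime; coprime-Bézout)
  open import Data.Nat.GCD using (module Bézout)
  import Data.Nat.Coprimality as Coprime
  open import Data.Integer using (ℤ; +_; -_; _+_; _-_; _*_)
  open import Data.Integer.Properties using (pos-+; pos-*; *-comm; +-comm; +-identityˡ; *-zeroʳ; neg-involutive; neg-distrib-+)
  open import Data.Integer.DivMod using (n%ℕd<d)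
  open import Data.Integer.Divisibility.Signed using (∣⇒∣ᵤ)
  open import Data.Nat.Divisibility using (∣⇒≤)
  open import Data.Nat.Properties using (≤-antisym; +-assoc)
  open import Data.Integer.Tactic.RingSolver using (solve-∀)
  open import Data.Fin using (Fin; toℕ; fromℕ<)
  open import Data.Fin.Properties using (toℕ-injective; toℕ<n; toℕ-fromℕ<)
  open import Data.Product using (_×_; _,_; ∃-syntax; proj₁; proj₂)
  open import Data.Sum using (_⊎_; inj₁; inj₂; map)
  open import Function using (_∘_; _⇔_; mk⇔; Equivalence)
  open import Function.Properties.Equivalence using (⇔-setoid) renaming (sym to ⇔-sym)
  open import Level using (0ℓ)
  open import Relation.Nullary using (¬_; yes; no; contradiction)
  open import Relation.Binary.PropositionalEquality using (_≡_; _≢_; refl; sym; trans; cong; subst; subst₂)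
  import Relation.Binary.Reasoning.Setoid as ≈-Reasoning

  open Congruence p
  open Equivalence

  instance
    p-nonZero : NonZero p
    p-nonZero = prime⇒nonZero prime

  ⟦_⟧ : Fin p → ℤ
  ⟦ x ⟧ = + toℕ x

  ⟦⟧-injective : ∀ {x y} → ⟦ x ⟧ ≈ ⟦ y ⟧ → x ≡ y
  ⟦⟧-injective = toℕ-injective ∘ +-injective-≈ (toℕ<n _) (toℕ<n _)

  reduce : ℤ → Fin p
  reduce i = fromℕ< (n%ℕd<d i p)

  ⟦reduce⟧ : ∀ i → ⟦ reduce i ⟧ ≈ i
  ⟦reduce⟧ i = subst (_≈ i) (cong +_ (sym (toℕ-fromℕ< _))) (≈-%ℕ i)

  ≡[p]⇔≈ : ∀ {m n} → m ≡[ p ] n ⇔ + m ≈ + n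
  ≡[p]⇔≈ {m} {n} = mk⇔
    (λ m%p≡n%p → ≈-trans (≈-sym (≈-%ℕ (+ m))) (≈-trans (≈-reflexive (cong +_ m%p≡n%p)) (≈-%ℕ (+ n))))
    (λ m≈n → +-injective-≈ (m%n<n m p) (m%n<n n p) (≈-trans (≈-%ℕ (+ m)) (≈-trans m≈n (≈-sym (≈-%ℕ (+ n))))))

  0ₚ 1ₚ : Fin p
  0ₚ = 0Fp p prime
  1ₚ = reduce (+ 1)

  infixl 6 _+ₚ_ _-ₚ_
  _+ₚ_ _-ₚ_ : Fin p → Fin p → Fin p
  x +ₚ y = reduce (⟦ x ⟧ + ⟦ y ⟧)
  x -ₚ y = reduce (⟦ x ⟧ - ⟦ y ⟧)

  -1ₚ : Fin p
  -1ₚ = 0ₚ -ₚ 1ₚ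

  ⟦1ₚ⟧ : ⟦ 1ₚ ⟧ ≈ + 1
  ⟦1ₚ⟧ = ⟦reduce⟧ (+ 1)

  ⟦+ₚ⟧ : ∀ x y → ⟦ x +ₚ y ⟧ ≈ ⟦ x ⟧ + ⟦ y ⟧
  ⟦+ₚ⟧ x y = ⟦reduce⟧ (⟦ x ⟧ + ⟦ y ⟧)

  ⟦-ₚ⟧ : ∀ x y → ⟦ x -ₚ y ⟧ ≈ ⟦ x ⟧ - ⟦ y ⟧
  ⟦-ₚ⟧ x y = ⟦reduce⟧ (⟦ x ⟧ - ⟦ y ⟧)

  ⟦0ₚ⟧ : ⟦ 0ₚ ⟧ ≡ + 0
  ⟦0ₚ⟧ = cong +_ (toℕ-fromℕ< _)

  nonZero⇔≉0 : ∀ {x} → NonZeroF p x ⇔ (¬ ⟦ x ⟧ ≈ + 0)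
  nonZero⇔≉0 {x} = mk⇔ (λ x≢0 x≈0 → x≢0 (+-injective-≈ (toℕ<n x) (ℕ.>-nonZero⁻¹ p) x≈0))
                       (λ x≉0 x≡0 → x≉0 (≈-reflexive (cong +_ x≡0)))

  integer-inverse : ∀ {x} → NonZeroF p x → ∃[ i ] ⟦ x ⟧ * i ≈ + 1
  integer-inverse {x} x≢0 with coprime-Bézout (Coprime.sym (prime⇒coprime prime {{≢-nonZero x≢0}} (toℕ<n x)))
  ... | Bézout.+- a b 1+bp≡ax = + a , (begin
    ⟦ x ⟧ * + a          ≡⟨ trans (pos-* a (toℕ x)) (*-comm (+ a) ⟦ x ⟧) ⟨
    + (a ℕ.* toℕ x)      ≡⟨ cong +_ 1+bp≡ax ⟨
    + (1 ℕ.+ b ℕ.* p)    ≈⟨ +[m+kp]≈+m 1 b ⟩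
    + 1                  ∎)
    where open ≈-Reasoning ≈-setoid
  ... | Bézout.-+ a b 1+ax≡bp = - + a , (begin
    ⟦ x ⟧ * - + a                  ≡⟨ x[-a]≡1-[1+ax] ⟦ x ⟧ (+ a) ⟩
    + 1 - (+ 1 + + a * ⟦ x ⟧)      ≡⟨ cong (λ k → + 1 - k) (trans (pos-+ 1 _) (cong (λ k → + 1 + k) (pos-* a (toℕ x)))) ⟨
    + 1 - + (1 ℕ.+ a ℕ.* toℕ x)    ≡⟨ cong (λ k → + 1 - + k) 1+ax≡bp ⟩
    + 1 - + (b ℕ.* p)              ≈⟨ +-cong (≈-refl {+ 1}) (-‿cong (+[m+kp]≈+m 0 b)) ⟩
    + 1                            ∎)
    where
      open ≈-Reasoning ≈-setoid
      x[-a]≡1-[1+ax] : ∀ x a → x * - a ≡ + 1 - (+ 1 + a * x)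
      x[-a]≡1-[1+ax] = solve-∀

  -- inv 0 is the junk value 0.
  inv : Fin p → Fin p
  inv x with toℕ x ℕ.≟ 0
  ... | yes _   = x
  ... | no x≢0 = reduce (proj₁ (integer-inverse x≢0))

  inv-inverse : ∀ {x} → NonZeroF p x → ⟦ x ⟧ * ⟦ inv x ⟧ ≈ + 1
  inv-inverse {x} x≢0 with toℕ x ℕ.≟ 0
  ... | yes x≡0  = contradiction x≡0 x≢0
  ... | no x≢0′ = ≈-trans (*-cong (≈-refl {⟦ x ⟧}) (⟦reduce⟧ (proj₁ (integer-inverse x≢0′)))) (proj₂ (integer-inverse x≢0′))

  ≡⇔⟦⟧≈ : ∀ {x y} → x ≡ y ⇔ ⟦ x ⟧ ≈ ⟦ y ⟧
  ≡⇔⟦⟧≈ = mk⇔ (≈-reflexive ∘ cong ⟦_⟧) ⟦⟧-injective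

  1≉0 : ¬ (+ 1 ≈ + 0)
  1≉0 1≈0 with +-injective-≈ (nonTrivial⇒n>1 p {{prime⇒nonTrivial prime}}) (ℕ.>-nonZero⁻¹ p) 1≈0
  ... | ()

  IsInv⇔ : ∀ x w → IsInv p x w ⇔ ⟦ x ⟧ * ⟦ w ⟧ ≈ + 1
  IsInv⇔ x w = mk⇔ (λ x*w≡1 → subst (_≈ + 1) (pos-* (toℕ x) (toℕ w)) (to ≡[p]⇔≈ x*w≡1))
                   (λ x*w≈1 → from ≡[p]⇔≈ (subst (_≈ + 1) (sym (pos-* (toℕ x) (toℕ w))) x*w≈1))

  inv-unique : ∀ {x w} → NonZeroF p x → ⟦ x ⟧ * ⟦ w ⟧ ≈ + 1 → inv x ≡ w
  inv-unique {x} x≢0 x*w≈1 = ⟦⟧-injective (inverse-unique {⟦ x ⟧} (inv-inverse x≢0) x*w≈1)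

  inv-nonZero : ∀ {x} → NonZeroF p x → NonZeroF p (inv x)
  inv-nonZero {x} x≢0 = from nonZero⇔≉0 λ x⁻¹≈0 → 1≉0 (begin
    + 1                ≈⟨ inv-inverse x≢0 ⟨
    ⟦ x ⟧ * ⟦ inv x ⟧   ≈⟨ *-cong (≈-refl {⟦ x ⟧}) x⁻¹≈0 ⟩
    ⟦ x ⟧ * + 0        ≡⟨ *-zeroʳ ⟦ x ⟧ ⟩
    + 0                ∎)
    where open ≈-Reasoning ≈-setoid

  inv-involutive : ∀ {x} → NonZeroF p x → inv (inv x) ≡ x
  inv-involutive {x} x≢0 = inv-unique (inv-nonZero x≢0) (subst (_≈ + 1) (*-comm ⟦ x ⟧ ⟦ inv x ⟧) (inv-inverse x≢0))

  reflect-involutive : ∀ t u → t -ₚ (t -ₚ u) ≡ u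
  reflect-involutive t u = ⟦⟧-injective (begin
    ⟦ t -ₚ (t -ₚ u) ⟧         ≈⟨ ⟦-ₚ⟧ t (t -ₚ u) ⟩
    ⟦ t ⟧ - ⟦ t -ₚ u ⟧        ≈⟨ +-cong (≈-refl {⟦ t ⟧}) (-‿cong (⟦-ₚ⟧ t u)) ⟩
    ⟦ t ⟧ - (⟦ t ⟧ - ⟦ u ⟧)   ≡⟨ t-[t-u]≡u ⟦ t ⟧ ⟦ u ⟧ ⟩
    ⟦ u ⟧                     ∎)
    where
      open ≈-Reasoning ≈-setoid
      t-[t-u]≡u : ∀ t u → t - (t - u) ≡ u
      t-[t-u]≡u = solve-∀

  ψ : Fin p → Fin p
  ψ x = x +ₚ inv x

  ⟦ψ⟧ : ∀ x → ⟦ ψ x ⟧ ≈ ⟦ x ⟧ + ⟦ inv x ⟧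
  ⟦ψ⟧ x = ⟦+ₚ⟧ x (inv x)

  ψ-inv : ∀ {x} → NonZeroF p x → ψ (inv x) ≡ ψ x
  ψ-inv {x} x≢0 = trans (cong (inv x +ₚ_) (inv-involutive x≢0)) (cong reduce (+-comm ⟦ inv x ⟧ ⟦ x ⟧))

  ψ-fibre : ∀ {x y} → NonZeroF p x → (NonZeroF p y × ψ y ≡ ψ x) ⇔ (x ≡ y ⊎ inv x ≡ y)
  ψ-fibre {x} {y} x≢0 = mk⇔ collide share
    where
      collide : NonZeroF p y × ψ y ≡ ψ x → x ≡ y ⊎ inv x ≡ y
      collide (y≢0 , ψy≡ψx) = map ⟦⟧-injective (inv-unique x≢0)
        (i+i′≈j+j′⇒i≈j∨ij≈1 prime {⟦ x ⟧} {⟦ inv x ⟧} {⟦ y ⟧} {⟦ inv y ⟧} (inv-inverse x≢0) (inv-inverse y≢0) sums≈)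
        where
          sums≈ : ⟦ x ⟧ + ⟦ inv x ⟧ ≈ ⟦ y ⟧ + ⟦ inv y ⟧
          sums≈ = ≈-trans (≈-sym (⟦ψ⟧ x)) (≈-trans (to ≡⇔⟦⟧≈ (sym ψy≡ψx)) (⟦ψ⟧ y))
      share : x ≡ y ⊎ inv x ≡ y → NonZeroF p y × ψ y ≡ ψ x
      share (inj₁ refl) = x≢0 , refl
      share (inj₂ refl) = inv-nonZero x≢0 , ψ-inv x≢0

  ⟦0ₚ-x⟧ : ∀ x → ⟦ 0ₚ -ₚ x ⟧ ≈ - ⟦ x ⟧
  ⟦0ₚ-x⟧ x = ≈-trans (⟦-ₚ⟧ 0ₚ x) (≈-reflexive (trans (cong (_- ⟦ x ⟧) ⟦0ₚ⟧) (+-identityˡ (- ⟦ x ⟧))))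

  ⟦-1ₚ⟧ : ⟦ -1ₚ ⟧ ≈ - + 1
  ⟦-1ₚ⟧ = ≈-trans (⟦0ₚ-x⟧ 1ₚ) (-‿cong ⟦1ₚ⟧)

  square≈1⇒self-inverse : ∀ {x} → ⟦ x ⟧ * ⟦ x ⟧ ≈ + 1 → NonZeroF p x × x ≡ inv x
  square≈1⇒self-inverse {x} x²≈1 = x≢0 , sym (inv-unique x≢0 x²≈1)
    where
      x≢0 : NonZeroF p x
      x≢0 = from nonZero⇔≉0 λ x≈0 → 1≉0 (≈-trans (≈-sym x²≈1) (*-cong x≈0 (≈-refl {⟦ x ⟧})))

  self-inverse⇔±1 : ∀ {x} → (NonZeroF p x × x ≡ inv x) ⇔ (1ₚ ≡ x ⊎ -1ₚ ≡ x)
  self-inverse⇔±1 {x} = mk⇔ roots (square≈1⇒self-inverse ∘ squares)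
    where
      roots : NonZeroF p x × x ≡ inv x → 1ₚ ≡ x ⊎ -1ₚ ≡ x
      roots (x≢0 , x≡x⁻¹) =
        map (λ x≈1 → ⟦⟧-injective (≈-trans ⟦1ₚ⟧ (≈-sym x≈1))) (λ x≈-1 → ⟦⟧-injective (≈-trans ⟦-1ₚ⟧ (≈-sym x≈-1)))
          (i*i≈1⇒i≈1∨i≈-1 prime {⟦ x ⟧} (subst (λ w → ⟦ x ⟧ * ⟦ w ⟧ ≈ + 1) (sym x≡x⁻¹) (inv-inverse x≢0)))
      squares : 1ₚ ≡ x ⊎ -1ₚ ≡ x → ⟦ x ⟧ * ⟦ x ⟧ ≈ + 1
      squares (inj₁ 1≡x)  = subst (λ w → ⟦ w ⟧ * ⟦ w ⟧ ≈ + 1) 1≡x (*-cong ⟦1ₚ⟧ ⟦1ₚ⟧)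
      squares (inj₂ -1≡x) = subst (λ w → ⟦ w ⟧ * ⟦ w ⟧ ≈ + 1) -1≡x (*-cong ⟦-1ₚ⟧ ⟦-1ₚ⟧)

  -- 1 ≈ -1 says p ∣ 2.
  1ₚ≢-1ₚ : p ≢ 2 → 1ₚ ≢ -1ₚ
  1ₚ≢-1ₚ p≢2 1≡-1 = p≢2 (≤-antisym (∣⇒≤ (∣⇒∣ᵤ (p∣i-j 1≈-1))) (nonTrivial⇒n>1 p {{prime⇒nonTrivial prime}}))
    where
      1≈-1 : + 1 ≈ - + 1
      1≈-1 = ≈-trans (≈-sym ⟦1ₚ⟧) (≈-trans (to ≡⇔⟦⟧≈ 1≡-1) ⟦-1ₚ⟧)

  neg-nonZero⇔ : ∀ {x} → NonZeroF p (0ₚ -ₚ x) ⇔ NonZeroF p x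
  neg-nonZero⇔ {x} = mk⇔ (λ -x≢0 → from nonZero⇔≉0 (to nonZero⇔≉0 -x≢0 ∘ ≈0⇒-≈0))
                          (λ x≢0 → from nonZero⇔≉0 (to nonZero⇔≉0 x≢0 ∘ -≈0⇒≈0))
    where
      ≈0⇒-≈0 : ⟦ x ⟧ ≈ + 0 → ⟦ 0ₚ -ₚ x ⟧ ≈ + 0
      ≈0⇒-≈0 x≈0 = ≈-trans (⟦0ₚ-x⟧ x) (-‿cong x≈0)
      -≈0⇒≈0 : ⟦ 0ₚ -ₚ x ⟧ ≈ + 0 → ⟦ x ⟧ ≈ + 0
      -≈0⇒≈0 -x≈0 = subst (_≈ + 0) (neg-involutive ⟦ x ⟧) (-‿cong (≈-trans (≈-sym (⟦0ₚ-x⟧ x)) -x≈0))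

  ψ-neg : ∀ {x} → NonZeroF p x → ψ (0ₚ -ₚ x) ≡ 0ₚ -ₚ ψ x
  ψ-neg {x} x≢0 = ⟦⟧-injective (begin
    ⟦ ψ (0ₚ -ₚ x) ⟧                          ≈⟨ ⟦ψ⟧ (0ₚ -ₚ x) ⟩
    ⟦ 0ₚ -ₚ x ⟧ + ⟦ inv (0ₚ -ₚ x) ⟧          ≡⟨ cong (λ w → ⟦ 0ₚ -ₚ x ⟧ + ⟦ w ⟧) inv-neg ⟩
    ⟦ 0ₚ -ₚ x ⟧ + ⟦ 0ₚ -ₚ inv x ⟧            ≈⟨ +-cong (⟦0ₚ-x⟧ x) (⟦0ₚ-x⟧ (inv x)) ⟩
    - ⟦ x ⟧ + - ⟦ inv x ⟧                    ≡⟨ neg-distrib-+ ⟦ x ⟧ ⟦ inv x ⟧ ⟨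
    - (⟦ x ⟧ + ⟦ inv x ⟧)                    ≈⟨ -‿cong (⟦ψ⟧ x) ⟨
    - ⟦ ψ x ⟧                                ≈⟨ ⟦0ₚ-x⟧ (ψ x) ⟨
    ⟦ 0ₚ -ₚ ψ x ⟧                            ∎)
    where
      open ≈-Reasoning ≈-setoid
      [-i][-j]≡ij : ∀ i j → - i * - j ≡ i * j
      [-i][-j]≡ij = solve-∀
      inv-neg : inv (0ₚ -ₚ x) ≡ 0ₚ -ₚ inv x
      inv-neg = inv-unique (from neg-nonZero⇔ x≢0) (begin
        ⟦ 0ₚ -ₚ x ⟧ * ⟦ 0ₚ -ₚ inv x ⟧   ≈⟨ *-cong (⟦0ₚ-x⟧ x) (⟦0ₚ-x⟧ (inv x)) ⟩
        - ⟦ x ⟧ * - ⟦ inv x ⟧           ≡⟨ [-i][-j]≡ij ⟦ x ⟧ ⟦ inv x ⟧ ⟩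
        ⟦ x ⟧ * ⟦ inv x ⟧               ≈⟨ inv-inverse x≢0 ⟩
        + 1                             ∎)

  ψ-equation⇔ : ∀ t x y →
    (toℕ x ℕ.+ toℕ (inv x) ℕ.+ toℕ y ℕ.+ toℕ (inv y)) ≡[ p ] toℕ t ⇔ ψ y ≡ t -ₚ ψ x
  ψ-equation⇔ t x y = begin
    (toℕ x ℕ.+ toℕ (inv x) ℕ.+ toℕ y ℕ.+ toℕ (inv y)) ≡[ p ] toℕ t  ≈⟨ ≡[p]⇔≈ ⟩
    + (toℕ x ℕ.+ toℕ (inv x) ℕ.+ toℕ y ℕ.+ toℕ (inv y)) ≈ ⟦ t ⟧    ≡⟨ cong (λ k → + k ≈ ⟦ t ⟧) reassociate ⟩
    (⟦ x ⟧ + ⟦ inv x ⟧) + (⟦ y ⟧ + ⟦ inv y ⟧) ≈ ⟦ t ⟧               ≈⟨ i+j≈k⇔j≈k-i {⟦ x ⟧ + ⟦ inv x ⟧} ⟩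
    ⟦ y ⟧ + ⟦ inv y ⟧ ≈ ⟦ t ⟧ - (⟦ x ⟧ + ⟦ inv x ⟧)                 ≈⟨ ≈-resp-⇔ (≈-sym (⟦ψ⟧ y)) (≈-sym ⟦t-ψx⟧) ⟩
    ⟦ ψ y ⟧ ≈ ⟦ t -ₚ ψ x ⟧                                         ≈⟨ ⇔-sym ≡⇔⟦⟧≈ ⟩
    ψ y ≡ t -ₚ ψ x                                                 ∎
    where
      open ≈-Reasoning (⇔-setoid 0ℓ)
      reassociate : toℕ x ℕ.+ toℕ (inv x) ℕ.+ toℕ y ℕ.+ toℕ (inv y) ≡ (toℕ x ℕ.+ toℕ (inv x)) ℕ.+ (toℕ y ℕ.+ toℕ (inv y))
      reassociate = +-assoc (toℕ x ℕ.+ toℕ (inv x)) (toℕ y) (toℕ (inv y))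
      ⟦t-ψx⟧ : ⟦ t -ₚ ψ x ⟧ ≈ ⟦ t ⟧ - (⟦ x ⟧ + ⟦ inv x ⟧)
      ⟦t-ψx⟧ = ≈-trans (⟦-ₚ⟧ t (ψ x)) (+-cong (≈-refl {⟦ t ⟧}) (-‿cong (⟦ψ⟧ x)))

  Sol⇔ : ∀ t x y → Sol p t (x , y) ⇔ (NonZeroF p x × NonZeroF p y × ψ y ≡ t -ₚ ψ x)
  Sol⇔ t x y = mk⇔ decode encode
    where
      decode : Sol p t (x , y) → NonZeroF p x × NonZeroF p y × ψ y ≡ t -ₚ ψ x
      decode (x≢0 , y≢0 , x′ , y′ , x*x′≡1 , y*y′≡1 , sum≡t) =
        x≢0 , y≢0 , to (ψ-equation⇔ t x y)
          (subst₂ (λ x′ y′ → (toℕ x ℕ.+ toℕ x′ ℕ.+ toℕ y ℕ.+ toℕ y′) ≡[ p ] toℕ t)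
                  (sym (inv-unique x≢0 (to (IsInv⇔ x x′) x*x′≡1))) (sym (inv-unique y≢0 (to (IsInv⇔ y y′) y*y′≡1))) sum≡t)
      encode : NonZeroF p x × NonZeroF p y × ψ y ≡ t -ₚ ψ x → Sol p t (x , y)
      encode (x≢0 , y≢0 , ψy≡t-ψx) =
        x≢0 , y≢0 , inv x , inv y , from (IsInv⇔ x (inv x)) (inv-inverse x≢0) , from (IsInv⇔ y (inv y)) (inv-inverse y≢0) ,
        from (ψ-equation⇔ t x y) ψy≡t-ψx

  toℕ≡0⇔0ₚ≡ : ∀ {x} → toℕ x ≡ 0 ⇔ 0ₚ ≡ x
  toℕ≡0⇔0ₚ≡ {x} = mk⇔ (λ x≡0 → toℕ-injective (trans (toℕ-fromℕ< _) (sym x≡0)))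
                      (λ 0ₚ≡x → trans (cong toℕ (sym 0ₚ≡x)) (toℕ-fromℕ< _))

module SolutionCount (p : ℕ) (prime : Prime p) where

  open import Data.Nat using (_+_; _*_; _∸_; _≤_)
  open import Data.Nat.Properties using (+-*-semiring)
  open import Algebra.Properties.Semiring.Sum +-*-semiring using (sum-syntax; sum-cong-≗; ∑-distrib-+; ∑-permute; *-distribˡ-sum)
  open import Data.Fin using (Fin; toℕ)
  open import Data.Fin.Properties using (_≟_)
  open import Data.Fin.Permutation using (Permutation; permutation)
  open import Data.Product using (_×_; _,_)
  open import Function using (_∘_; Equivalence)
  open import Relation.Nullary using (Dec; yes; no; ¬?; _×-dec_)
  open import Relation.Binary.PropositionalEquality using (_≡_; _≢_; refl; sym; trans; cong; cong₂; module ≡-Reasoning)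
  import Data.Nat as ℕ
  import Data.Nat.Properties as ℕ

  open Counting
  open PrimeField p prime
  open Equivalence

  nonZero? : (x : Fin p) → Dec (NonZeroF p x)
  nonZero? x = ¬? (toℕ x ℕ.≟ 0)

  ι : Fin p → ℕ
  ι x = 𝟙 (nonZero? x)

  r : Fin p → ℕ
  r u = ∑[ y < p ] (ι y * 𝟙 (ψ y ≟ u))

  reflection : Fin p → Permutation p p
  reflection t = permutation (t -ₚ_) (t -ₚ_) (reflect-involutive t) (reflect-involutive t)

  Np≡∑ι*r : ∀ t → Np p prime t ≡ ∑[ x < p ] (ι x * r (t -ₚ ψ x))
  Np≡∑ι*r t = begin
    Np p prime t                                                   ≡⟨ count-allFin² (sol? p t) ⟩
    ∑[ x < p ] ∑[ y < p ] 𝟙 (sol? p t (x , y))                     ≡⟨ sum-cong-≗ (λ x → sum-cong-≗ (decode x)) ⟩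
    ∑[ x < p ] ∑[ y < p ] (ι x * (ι y * 𝟙 (ψ y ≟ t -ₚ ψ x)))       ≡⟨ sum-cong-≗ factor-ι ⟨
    ∑[ x < p ] (ι x * r (t -ₚ ψ x))                                 ∎
    where
      open ≡-Reasoning
      factor-ι : ∀ x → ι x * r (t -ₚ ψ x) ≡ ∑[ y < p ] (ι x * (ι y * 𝟙 (ψ y ≟ t -ₚ ψ x)))
      factor-ι x = *-distribˡ-sum (ι x) (λ y → ι y * 𝟙 (ψ y ≟ t -ₚ ψ x))
      decode : ∀ x y → 𝟙 (sol? p t (x , y)) ≡ ι x * (ι y * 𝟙 (ψ y ≟ t -ₚ ψ x))
      decode x y = begin
        𝟙 (sol? p t (x , y))                                           ≡⟨ 𝟙-cong (Sol⇔ t x y) _ _ ⟩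
        𝟙 (nonZero? x ×-dec (nonZero? y ×-dec (ψ y ≟ t -ₚ ψ x)))       ≡⟨ 𝟙-×-dec (nonZero? x) _ ⟨
        ι x * 𝟙 (nonZero? y ×-dec (ψ y ≟ t -ₚ ψ x))                    ≡⟨ cong (ι x *_) (𝟙-×-dec (nonZero? y) _) ⟨
        ι x * (ι y * 𝟙 (ψ y ≟ t -ₚ ψ x))                               ∎

  -- ∑_u r(u)², the number of pairs (x , y) ∈ (𝔽_p^*)² with ψ x ≡ ψ y.
  collisions : ℕ
  collisions = ∑[ x < p ] (ι x * r (ψ x))

  Np≤collisions : ∀ t → Np p prime t ≤ collisions
  Np≤collisions t = begin
    Np p prime t                     ≡⟨ Np≡∑ι*r t ⟩
    ∑[ x < p ] (ι x * r (t -ₚ ψ x))  ≡⟨ ∑-fibres ι ψ (r ∘ (t -ₚ_)) ⟩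
    ∑[ u < p ] (r u * r (t -ₚ u))    ≤⟨ ∑-*-permute-≤ (reflection t) r ⟩
    ∑[ u < p ] (r u * r u)           ≡⟨ ∑-fibres ι ψ r ⟨
    collisions                       ∎
    where open ℕ.≤-Reasoning

  Np[0]≡collisions : Np p prime 0ₚ ≡ collisions
  Np[0]≡collisions = begin
    Np p prime 0ₚ                                  ≡⟨ Np≡∑ι*r 0ₚ ⟩
    ∑[ x < p ] (ι x * r (0ₚ -ₚ ψ x))               ≡⟨ sum-cong-≗ odd ⟩
    ∑[ x < p ] (ι (0ₚ -ₚ x) * r (ψ (0ₚ -ₚ x)))     ≡⟨ ∑-permute (λ x → ι x * r (ψ x)) (reflection 0ₚ) ⟨
    collisions                                     ∎
    where
      open ≡-Reasoning
      odd : ∀ x → ι x * r (0ₚ -ₚ ψ x) ≡ ι (0ₚ -ₚ x) * r (ψ (0ₚ -ₚ x))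
      odd x with nonZero? x
      ... | yes x≢0 = cong₂ _*_ (sym (𝟙-yes (from neg-nonZero⇔ x≢0) (nonZero? (0ₚ -ₚ x)))) (cong r (sym (ψ-neg x≢0)))
      ... | no ¬x≢0 = cong (_* r (ψ (0ₚ -ₚ x))) (sym (𝟙-no (¬x≢0 ∘ to neg-nonZero⇔) (nonZero? (0ₚ -ₚ x))))

  r[ψx]+𝟙[x≡x⁻¹]≡2 : ∀ {x} → NonZeroF p x → r (ψ x) + 𝟙 (x ≟ inv x) ≡ 2
  r[ψx]+𝟙[x≡x⁻¹]≡2 {x} x≢0 = trans (cong (_+ 𝟙 (x ≟ inv x)) (sum-cong-≗ λ y → 𝟙-×-dec (nonZero? y) (ψ y ≟ ψ x)))
                                        (∑-𝟙-pair (λ y → nonZero? y ×-dec (ψ y ≟ ψ x)) x (inv x) λ _ → ψ-fibre x≢0)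

  ∑ι*𝟙[x≡x⁻¹]≡2 : p ≢ 2 → ∑[ x < p ] (ι x * 𝟙 (x ≟ inv x)) ≡ 2
  ∑ι*𝟙[x≡x⁻¹]≡2 p≢2 = begin
    ∑[ x < p ] (ι x * 𝟙 (x ≟ inv x))              ≡⟨ sum-cong-≗ (λ x → 𝟙-×-dec (nonZero? x) (x ≟ inv x)) ⟩
    ∑[ x < p ] 𝟙 (self-inverse? x)                ≡⟨ ℕ.+-identityʳ _ ⟨
    ∑[ x < p ] 𝟙 (self-inverse? x) + 0            ≡⟨ cong (∑[ x < p ] 𝟙 (self-inverse? x) +_) (𝟙-no (1ₚ≢-1ₚ p≢2) (1ₚ ≟ -1ₚ)) ⟨
    ∑[ x < p ] 𝟙 (self-inverse? x) + 𝟙 (1ₚ ≟ -1ₚ) ≡⟨ ∑-𝟙-pair self-inverse? 1ₚ -1ₚ (λ _ → self-inverse⇔±1) ⟩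
    2                                             ∎
    where
      open ≡-Reasoning
      self-inverse? : (x : Fin p) → Dec (NonZeroF p x × x ≡ inv x)
      self-inverse? x = nonZero? x ×-dec (x ≟ inv x)

  ∑ι+1≡p : ∑[ x < p ] ι x + 1 ≡ p
  ∑ι+1≡p = begin
    ∑[ x < p ] ι x + 1                             ≡⟨ cong (∑[ x < p ] ι x +_) zeros ⟨
    ∑[ x < p ] ι x + ∑[ x < p ] 𝟙 (toℕ x ℕ.≟ 0)    ≡⟨ ∑-distrib-+ ι (λ x → 𝟙 (toℕ x ℕ.≟ 0)) ⟨
    ∑[ x < p ] (ι x + 𝟙 (toℕ x ℕ.≟ 0))             ≡⟨ sum-cong-≗ {p} (λ x → 𝟙-¬?+𝟙 (toℕ x ℕ.≟ 0)) ⟩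
    ∑[ x < p ] 1                                   ≡⟨ ∑-one p ⟩
    p                                              ∎
    where
      open ≡-Reasoning
      zeros : ∑[ x < p ] 𝟙 (toℕ x ℕ.≟ 0) ≡ 1
      zeros = ∑-𝟙-unique (λ x → toℕ x ℕ.≟ 0) 0ₚ (λ _ → toℕ≡0⇔0ₚ≡)

  collisions+2≡2[p-1] : p ≢ 2 → collisions + 2 ≡ 2 * (p ∸ 1)
  collisions+2≡2[p-1] p≢2 = begin
    collisions + 2                                     ≡⟨ cong (collisions +_) (∑ι*𝟙[x≡x⁻¹]≡2 p≢2) ⟨
    collisions + ∑[ x < p ] (ι x * 𝟙 (x ≟ inv x))      ≡⟨ ∑-distrib-+ (λ x → ι x * r (ψ x)) (λ x → ι x * 𝟙 (x ≟ inv x)) ⟨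
    ∑[ x < p ] (ι x * r (ψ x) + ι x * 𝟙 (x ≟ inv x))   ≡⟨ sum-cong-≗ twice ⟩
    ∑[ x < p ] (2 * ι x)                               ≡⟨ *-distribˡ-sum 2 ι ⟨
    2 * ∑[ x < p ] ι x                                 ≡⟨ cong (2 *_) ∑ι≡p-1 ⟩
    2 * (p ∸ 1)                                        ∎
    where
      open ≡-Reasoning
      ∑ι≡p-1 : ∑[ x < p ] ι x ≡ p ∸ 1
      ∑ι≡p-1 = trans (sym (ℕ.m+n∸n≡m (∑[ x < p ] ι x) 1)) (cong (_∸ 1) ∑ι+1≡p)
      twice : ∀ x → ι x * r (ψ x) + ι x * 𝟙 (x ≟ inv x) ≡ 2 * ι x
      twice x with nonZero? x
      ... | yes x≢0 = trans (cong₂ _+_ (ℕ.*-identityˡ (r (ψ x))) (ℕ.*-identityˡ (𝟙 (x ≟ inv x)))) (r[ψx]+𝟙[x≡x⁻¹]≡2 x≢0)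
      ... | no _    = refl

  collisions≡2p-4 : p ≢ 2 → collisions ≡ 2 * p ∸ 4
  collisions≡2p-4 p≢2 = begin
    collisions            ≡⟨ ℕ.m+n∸n≡m collisions 2 ⟨
    collisions + 2 ∸ 2    ≡⟨ cong (_∸ 2) (collisions+2≡2[p-1] p≢2) ⟩
    2 * (p ∸ 1) ∸ 2       ≡⟨ cong (_∸ 2) (ℕ.*-distribˡ-∸ 2 p 1) ⟩
    2 * p ∸ 2 ∸ 2         ≡⟨ ℕ.∸-+-assoc (2 * p) 2 2 ⟩
    2 * p ∸ 4             ∎
    where open ≡-Reasoning

open import Data.Nat using (_*_; _∸_; _≤_)
open import Data.Fin using (Fin)
open import Data.Product using (_×_; _,_)
open import Relation.Binary.PropositionalEquality using (_≡_; _≢_; sym; trans; subst)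

mainTheorem3 : (p : ℕ) (pp : Prime p) → p ≢ 2 →
    ((t : Fin p) → Np p pp t ≤ Np p pp (0Fp p pp)) × (Np p pp (0Fp p pp) ≡ 2 * p ∸ 4)
mainTheorem3 p pp p≢2 =
  (λ t → subst (Np p pp t ≤_) (sym Np[0]≡collisions) (Np≤collisions t)) , trans Np[0]≡collisions (collisions≡2p-4 p≢2)
  where open SolutionCount p pp
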